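{- Let $\mathfrak L$ be the structure with domain $\mathbb Q$ and signature $\tau_0 := \{<,1\}\cup\{c\cdot\}_{c\in\mathbb Q}$, where $<$ is interpreted as the strict linear order of $\mathbb Q$, the constant symbol $1$ is interpreted as the rational number $1$, and for each $c\in\mathbb Q$ the unary function symbol $c\cdot$ is interpreted as the map $x\mapsto cx$. Then $\mathfrak L$ has quantifier elimination: every first-order $\tau_0$-formula is equivalent over $\mathfrak L$ to a quantifier-free $\tau_0$-formula.
   Context: First-order formulas are built from atomic formulas (including the special atomic formulas $\top$ and $\bot$ for truth and falsity) using connectives and quantifiers. Two formulas are equivalent over a structure if they are satisfied by the same assignments of elements to their free variables. -}

module Defs where

open import Data.Nat using (ℕ; suc)
open import Data.Fin using (Fin; zero; suc)
open import Data.Rational using (ℚ; _<_; _*_; 1ℚ)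
open import Data.Product using (Σ; _×_)
open import Data.Sum using (_⊎_)
open import Data.Unit using (⊤)
open import Data.Empty using (⊥)
open import Relation.Binary.PropositionalEquality using (_≡_)
open import Function.Bundles using (_⇔_)

-- Terms of signature τ₀ = {<, 1} ∪ {c· | c ∈ ℚ}, with de Bruijn variables
-- ranging over Fin n (n = number of variables in scope).
data Term (n : ℕ) : Set where
  var   : Fin n → Term n
  one   : Term n
  scale : ℚ → Term n → Term n

data Formula (n : ℕ) : Set where
  ⊤ᶠ  : Formula n
  ⊥ᶠ  : Formula n
  _≐_ : Term n → Term n → Formula n
  _≺_ : Term n → Term n → Formula n
  ¬ᶠ_ : Formula n → Formula n
  _∧ᶠ_ : Formula n → Formula n → Formula n
  _∨ᶠ_ : Formula n → Formula n → Formula n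
  _⇒ᶠ_ : Formula n → Formula n → Formula n
  ∀ᶠ  : Formula (suc n) → Formula n
  ∃ᶠ  : Formula (suc n) → Formula n

data QF {n : ℕ} : Formula n → Set where
  ⊤ᶠ  : QF ⊤ᶠ
  ⊥ᶠ  : QF ⊥ᶠ
  _≐_ : (s t : Term n) → QF (s ≐ t)
  _≺_ : (s t : Term n) → QF (s ≺ t)
  ¬ᶠ_ : ∀ {φ} → QF φ → QF (¬ᶠ φ)
  _∧ᶠ_ : ∀ {φ ψ} → QF φ → QF ψ → QF (φ ∧ᶠ ψ)
  _∨ᶠ_ : ∀ {φ ψ} → QF φ → QF ψ → QF (φ ∨ᶠ ψ)
  _⇒ᶠ_ : ∀ {φ ψ} → QF φ → QF ψ → QF (φ ⇒ᶠ ψ)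

Assignment : ℕ → Set
Assignment n = Fin n → ℚ

_∷ₐ_ : ∀ {n} → ℚ → Assignment n → Assignment (suc n)
(a ∷ₐ ρ) zero    = a
(a ∷ₐ ρ) (suc i) = ρ i

⟦_⟧ₜ : ∀ {n} → Term n → Assignment n → ℚ
⟦ var i ⟧ₜ     ρ = ρ i
⟦ one ⟧ₜ       ρ = 1ℚ
⟦ scale c t ⟧ₜ ρ = c * ⟦ t ⟧ₜ ρ

_⊨_ : ∀ {n} → Assignment n → Formula n → Set
ρ ⊨ ⊤ᶠ       = ⊤
ρ ⊨ ⊥ᶠ       = ⊥
ρ ⊨ (s ≐ t)  = ⟦ s ⟧ₜ ρ ≡ ⟦ t ⟧ₜ ρ
ρ ⊨ (s ≺ t)  = ⟦ s ⟧ₜ ρ < ⟦ t ⟧ₜ ρ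
ρ ⊨ (¬ᶠ φ)   = ρ ⊨ φ → ⊥
ρ ⊨ (φ ∧ᶠ ψ) = ρ ⊨ φ × ρ ⊨ ψ
ρ ⊨ (φ ∨ᶠ ψ) = ρ ⊨ φ ⊎ ρ ⊨ ψ
ρ ⊨ (φ ⇒ᶠ ψ) = ρ ⊨ φ → ρ ⊨ ψ
ρ ⊨ ∀ᶠ φ     = (a : ℚ) → (a ∷ₐ ρ) ⊨ φ
ρ ⊨ ∃ᶠ φ     = Σ ℚ λ a → (a ∷ₐ ρ) ⊨ φ

Equivalent : ∀ {n} → Formula n → Formula n → Set
Equivalent φ ψ = (ρ : Assignment _) → (ρ ⊨ φ) ⇔ (ρ ⊨ ψ)

HasQE : Set
HasQE = ∀ {n} (φ : Formula n) → Σ (Formula n) λ ψ → QF ψ × Equivalent φ ψ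

-- Every term is c·x or free of x, so after dividing by coefficients every
-- quantifier-free formula in x is a boolean combination of x-free atoms and atoms
-- x < w, x = w, w < x with w free of x (c·x r d·x becomes (c − d)·x r 0). Its truth
-- depends only on the position of x relative to the finitely many bounds w, so ∃x
-- is witnessed by a point below all bounds, by a bound itself, or by a point just
-- above a bound and below all larger ones; by density and the absence of endpoints
-- each case is expressed without x. Universal quantifiers reduce to existential
-- ones because quantifier-free formulas are decidable.
module Submission where

open import Level using (0ℓ)
open import Data.Nat using (ℕ; suc)
open import Data.Fin using (zero; suc)
open import Data.Rational as ℚ
  using (ℚ; _<_; _≤_; _*_; _+_; _-_; -_; 1/_; 0ℚ; 1ℚ; Positive; Negative; NonZero; _≟_)
open import Data.Rational.Properties
open import Data.Product using (Σ; ∃; _×_; _,_)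
open import Data.Product.Function.Dependent.Propositional using (Σ-⇔)
open import Data.Product.Function.NonDependent.Propositional using (_×-⇔_)
open import Data.Sum using (_⊎_; inj₁; inj₂)
open import Data.Sum.Function.Propositional using (_⊎-⇔_)
open import Data.Unit using (tt)
open import Data.Empty using (⊥-elim)
open import Data.List using (List; []; _∷_; _++_; foldr)
open import Data.List.Membership.Propositional using (_∈_; lose)
open import Data.List.Relation.Unary.All as All using (All; []; _∷_; universal)
open import Data.List.Relation.Unary.All.Properties using (++⁻ˡ; ++⁻ʳ; ¬Any⇒All¬)
open import Data.List.Relation.Unary.Any as Any using (Any; here; there; any?; satisfied)
open import Function.Base using (_∘_)
open import Function.Bundles using (_⇔_; mk⇔; Equivalence)
open Equivalence using (to; from)
open import Function.Construct.Identity using (↠-id)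
import Function.Properties.Equivalence as ⇔
open import Function.Related.TypeIsomorphisms using (→-cong-⇔; ¬-cong-⇔)
open import Relation.Binary.Definitions using (tri<; tri≈; tri>)
open import Relation.Binary.PropositionalEquality
  using (_≡_; _≢_; refl; sym; trans; cong; subst; module ≡-Reasoning)
open import Relation.Nullary using (Dec; yes; no; ¬_)
open import Relation.Nullary.Decidable using (¬?; _×-dec_; _⊎-dec_; _→-dec_; decidable-stable)
open import Relation.Nullary.Negation using (∀⟶¬∃¬)
import Relation.Binary.Reasoning.Setoid as SetoidReasoning

open import Defs

module ⇔-Reasoning = SetoidReasoning (⇔.⇔-setoid 0ℓ)

Π-cong-⇔ : {A : Set} {P Q : A → Set} → (∀ a → P a ⇔ Q a) → ((a : A) → P a) ⇔ ((a : A) → Q a)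
Π-cong-⇔ e = mk⇔ (λ f a → to (e a) (f a)) (λ g a → from (e a) (g a))

∃-cong-⇔ : {A : Set} {P Q : A → Set} → (∀ a → P a ⇔ Q a) → ∃ P ⇔ ∃ Q
∃-cong-⇔ e = Σ-⇔ (↠-id _) (e _)

∀⇔¬∃¬ : {A : Set} {P : A → Set} → (∀ a → Dec (P a)) → ((a : A) → P a) ⇔ (¬ ∃ λ a → ¬ P a)
∀⇔¬∃¬ P? = mk⇔ ∀⟶¬∃¬ (λ ¬∃¬ a → decidable-stable (P? a) (λ ¬p → ¬∃¬ (a , ¬p)))

p*[1/p*q]≡q : ∀ p .{{_ : NonZero p}} q → p * (1/ p * q) ≡ q
p*[1/p*q]≡q p q = begin
  p * (1/ p * q)  ≡⟨ *-assoc p (1/ p) q ⟨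
  p * 1/ p * q    ≡⟨ cong (_* q) (*-inverseʳ p) ⟩
  1ℚ * q          ≡⟨ *-identityˡ q ⟩
  q               ∎
  where open ≡-Reasoning

1/p*[p*q]≡q : ∀ p .{{_ : NonZero p}} q → 1/ p * (p * q) ≡ q
1/p*[p*q]≡q p q = begin
  1/ p * (p * q)  ≡⟨ *-assoc (1/ p) p q ⟨
  1/ p * p * q    ≡⟨ cong (_* q) (*-inverseˡ p) ⟩
  1ℚ * q          ≡⟨ *-identityˡ q ⟩
  q               ∎
  where open ≡-Reasoning

*-cancelˡ-≡ : ∀ p .{{_ : NonZero p}} {q r} → p * q ≡ p * r → q ≡ r
*-cancelˡ-≡ p {q} {r} pq≡pr = begin
  q               ≡⟨ 1/p*[p*q]≡q p q ⟨
  1/ p * (p * q)  ≡⟨ cong (1/ p *_) pq≡pr ⟩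
  1/ p * (p * r)  ≡⟨ 1/p*[p*q]≡q p r ⟩
  r               ∎
  where open ≡-Reasoning

[p+q]-q≡p : ∀ p q → (p + q) - q ≡ p
[p+q]-q≡p p q = begin
  (p + q) - q     ≡⟨ +-assoc p q (- q) ⟩
  p + (q - q)     ≡⟨ cong (p +_) (+-inverseʳ q) ⟩
  p + 0ℚ          ≡⟨ +-identityʳ p ⟩
  p               ∎
  where open ≡-Reasoning

[p-q]*r≡p*r-q*r : ∀ p q r → (p - q) * r ≡ p * r - q * r
[p-q]*r≡p*r-q*r p q r = begin
  (p - q) * r       ≡⟨ *-distribʳ-+ r p (- q) ⟩
  p * r + - q * r   ≡⟨ cong (p * r +_) (neg-distribˡ-* q r) ⟨
  p * r - q * r     ∎
  where open ≡-Reasoning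

p-1<p : ∀ p → p - 1ℚ < p
p-1<p p = subst (p - 1ℚ <_) (+-identityʳ p) (+-monoʳ-< p (negative⁻¹ (- 1ℚ)))

p<p+1 : ∀ p → p < p + 1ℚ
p<p+1 p = subst (_< p + 1ℚ) (+-identityʳ p) (+-monoʳ-< p (positive⁻¹ 1ℚ))

data Rel : Set where
  lt eq gt : Rel

Holds : Rel → ℚ → ℚ → Set
Holds lt p q = p < q
Holds eq p q = p ≡ q
Holds gt p q = q < p

converse : Rel → Rel
converse lt = gt
converse eq = eq
converse gt = lt

Holds-cong : ∀ r {p p′ q q′} → p ≡ p′ → q ≡ q′ → Holds r p q ⇔ Holds r p′ q′
Holds-cong r refl refl = ⇔.refl

Holds-converse : ∀ r {p q} → Holds r p q ⇔ Holds (converse r) q p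
Holds-converse lt = ⇔.refl
Holds-converse eq = mk⇔ sym sym
Holds-converse gt = ⇔.refl

Holds-+ : ∀ r s {p q} → Holds r p q → Holds r (p + s) (q + s)
Holds-+ lt s = +-monoˡ-< s
Holds-+ eq s = cong (_+ s)
Holds-+ gt s = +-monoˡ-< s

Holds-+-⇔ : ∀ r s {p q} → Holds r (p + s) (q + s) ⇔ Holds r p q
Holds-+-⇔ r s {p} {q} = mk⇔ cancel (Holds-+ r s)
  where
  cancel : Holds r (p + s) (q + s) → Holds r p q
  cancel h = to (Holds-cong r ([p+q]-q≡p p s) ([p+q]-q≡p q s)) (Holds-+ r (- s) h)

Holds-difference : ∀ r {p q} → Holds r p q ⇔ Holds r (p - q) 0ℚ
Holds-difference r {p} {q} = begin
  Holds r p q                  ≈⟨ Holds-+-⇔ r (- q) ⟨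
  Holds r (p - q) (q - q)      ≈⟨ Holds-cong r refl (+-inverseʳ q) ⟩
  Holds r (p - q) 0ℚ           ∎
  where open ⇔-Reasoning

Holds-*-pos : ∀ r c .{{_ : Positive c}} {p q} → Holds r (c * p) (c * q) ⇔ Holds r p q
Holds-*-pos lt c = mk⇔ (*-cancelˡ-<-nonNeg c) (*-monoʳ-<-pos c)
  where instance _ = pos⇒nonNeg c
Holds-*-pos eq c = mk⇔ (*-cancelˡ-≡ c) (cong (c *_))
  where instance _ = pos⇒nonZero c
Holds-*-pos gt c = mk⇔ (*-cancelˡ-<-nonNeg c) (*-monoʳ-<-pos c)
  where instance _ = pos⇒nonNeg c

Holds-*-neg : ∀ r c .{{_ : Negative c}} {p q} → Holds r (c * p) (c * q) ⇔ Holds (converse r) p q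
Holds-*-neg lt c = mk⇔ (*-cancelˡ-<-nonPos c) (*-monoʳ-<-neg c)
  where instance _ = neg⇒nonPos c
Holds-*-neg eq c = mk⇔ (*-cancelˡ-≡ c) (cong (c *_))
  where instance _ = neg⇒nonZero c
Holds-*-neg gt c = mk⇔ (*-cancelˡ-<-nonPos c) (*-monoʳ-<-neg c)
  where instance _ = neg⇒nonPos c

module _ {A : Set} (f : A → ℚ) where

  -- No value of f on the list lies in the half-open interval (p , q].
  Gap : ℚ → ℚ → List A → Set
  Gap p q = All (λ w → p < f w → q < f w)

  Gap-shrinkˡ : ∀ {p p′ q ws} → p ≤ p′ → Gap p q ws → Gap p′ q ws
  Gap-shrinkˡ p≤p′ = All.map (λ h p′<w → h (≤-<-trans p≤p′ p′<w))

  Gap-shrinkʳ : ∀ {p q q′ ws} → q′ ≤ q → Gap p q ws → Gap p q′ ws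
  Gap-shrinkʳ q′≤q = All.map (λ h p<w → ≤-<-trans q′≤q (h p<w))

  Gap-below-all : ∀ {p q ws} → All (λ w → q < f w) ws → Gap p q ws
  Gap-below-all = All.map (λ q<w _ → q<w)

  lower-bound : ∀ ws → ∃ λ a → All (λ w → a < f w) ws
  lower-bound [] = 0ℚ , []
  lower-bound (v ∷ ws) with lower-bound ws
  ... | a , a<ws with a <? f v
  ...   | yes a<v = a , a<v ∷ a<ws
  ...   | no a≮v  = f v - 1ℚ , p-1<p (f v) ∷ All.map (<-trans (<-≤-trans (p-1<p (f v)) (≮⇒≥ a≮v))) a<ws

  gap-above : ∀ p ws → ∃ λ q → p < q × Gap p q ws
  gap-above p [] = p + 1ℚ , p<p+1 p , []
  gap-above p (v ∷ ws) with gap-above p ws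
  ... | q , p<q , gap with q <? f v | p <? f v
  ...   | yes q<v | _       = q , p<q , (λ _ → q<v) ∷ gap
  ...   | no _    | no p≮v  = q , p<q , (⊥-elim ∘ p≮v) ∷ gap
  ...   | no q≮v  | yes p<v with <-dense p<v
  ...     | z , p<z , z<v = z , p<z , (λ _ → z<v) ∷ Gap-shrinkʳ (<⇒≤ (<-≤-trans z<v (≮⇒≥ q≮v))) gap

  below-all-or-gap : ∀ a ws → All (λ w → a ≢ f w) ws →
                     All (λ w → a < f w) ws ⊎ ∃ λ t → t ∈ ws × f t < a × Gap (f t) a ws
  below-all-or-gap a [] [] = inj₁ []
  below-all-or-gap a (u ∷ ws) (a≢u ∷ a≢ws) with <-cmp a (f u) | below-all-or-gap a ws a≢ws
  ... | tri≈ _ a≡u _ | _                           = ⊥-elim (a≢u a≡u)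
  ... | tri< a<u _ _ | inj₁ a<ws                   = inj₁ (a<u ∷ a<ws)
  ... | tri< a<u _ _ | inj₂ (t , t∈ws , t<a , gap) = inj₂ (t , there t∈ws , t<a , (λ _ → a<u) ∷ gap)
  ... | tri> _ _ u<a | inj₁ a<ws                   = inj₂ (u , here refl , u<a , (⊥-elim ∘ <-irrefl refl) ∷ Gap-below-all a<ws)
  ... | tri> _ _ u<a | inj₂ (t , t∈ws , t<a , gap) with f t <? f u
  ...   | yes t<u = inj₂ (u , here refl , u<a , (⊥-elim ∘ <-irrefl refl) ∷ Gap-shrinkˡ (<⇒≤ t<u) gap)
  ...   | no t≮u  = inj₂ (t , there t∈ws , t<a , (⊥-elim ∘ t≮u) ∷ gap)

QF-dec : ∀ {n} {φ : Formula n} → QF φ → (ρ : Assignment n) → Dec (ρ ⊨ φ)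
QF-dec ⊤ᶠ       ρ = yes tt
QF-dec ⊥ᶠ       ρ = no λ ()
QF-dec (s ≐ t)  ρ = ⟦ s ⟧ₜ ρ ≟ ⟦ t ⟧ₜ ρ
QF-dec (s ≺ t)  ρ = ⟦ s ⟧ₜ ρ <? ⟦ t ⟧ₜ ρ
QF-dec (¬ᶠ q)   ρ = ¬? (QF-dec q ρ)
QF-dec (q ∧ᶠ r) ρ = QF-dec q ρ ×-dec QF-dec r ρ
QF-dec (q ∨ᶠ r) ρ = QF-dec q ρ ⊎-dec QF-dec r ρ
QF-dec (q ⇒ᶠ r) ρ = QF-dec q ρ →-dec QF-dec r ρ

relᶠ : ∀ {n} → Rel → Term n → Term n → Formula n
relᶠ lt s t = s ≺ t
relᶠ eq s t = s ≐ t
relᶠ gt s t = t ≺ s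

relᶠ-QF : ∀ {n} r (s t : Term n) → QF (relᶠ r s t)
relᶠ-QF lt s t = s ≺ t
relᶠ-QF eq s t = s ≐ t
relᶠ-QF gt s t = t ≺ s

relᶠ-sound : ∀ {n} (ρ : Assignment n) r s t → ρ ⊨ relᶠ r s t ⇔ Holds r (⟦ s ⟧ₜ ρ) (⟦ t ⟧ₜ ρ)
relᶠ-sound ρ lt s t = ⇔.refl
relᶠ-sound ρ eq s t = ⇔.refl
relᶠ-sound ρ gt s t = ⇔.refl

⋁ : ∀ {n} {A : Set} → (A → Formula n) → List A → Formula n
⋁ φ = foldr (λ a ψ → φ a ∨ᶠ ψ) ⊥ᶠ

⋁-QF : ∀ {n} {A : Set} {φ : A → Formula n} → (∀ a → QF (φ a)) → ∀ as → QF (⋁ φ as)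
⋁-QF q []       = ⊥ᶠ
⋁-QF q (a ∷ as) = q a ∨ᶠ ⋁-QF q as

⋁-sound : ∀ {n} {A : Set} (ρ : Assignment n) (φ : A → Formula n) as → ρ ⊨ ⋁ φ as ⇔ Any (λ a → ρ ⊨ φ a) as
⋁-sound ρ φ as = mk⇔ (⋁⇒Any as) (Any⇒⋁ as)
  where
  ⋁⇒Any : ∀ as → ρ ⊨ ⋁ φ as → Any (λ a → ρ ⊨ φ a) as
  ⋁⇒Any (a ∷ as) (inj₁ s) = here s
  ⋁⇒Any (a ∷ as) (inj₂ s) = there (⋁⇒Any as s)
  Any⇒⋁ : ∀ as → Any (λ a → ρ ⊨ φ a) as → ρ ⊨ ⋁ φ as
  Any⇒⋁ (a ∷ as) (here s)  = inj₁ s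
  Any⇒⋁ (a ∷ as) (there s) = inj₂ (Any⇒⋁ as s)

data Linear (n : ℕ) : Set where
  _·x   : ℚ → Linear n
  fixed : Term n → Linear n

⟦_⟧ˡ : ∀ {n} → Linear n → ℚ → Assignment n → ℚ
⟦ c ·x ⟧ˡ    a ρ = c * a
⟦ fixed u ⟧ˡ a ρ = ⟦ u ⟧ₜ ρ

scaleˡ : ∀ {n} → ℚ → Linear n → Linear n
scaleˡ c (d ·x)    = (c * d) ·x
scaleˡ c (fixed u) = fixed (scale c u)

linearise : ∀ {n} → Term (suc n) → Linear n
linearise (var zero)    = 1ℚ ·x
linearise (var (suc i)) = fixed (var i)
linearise one           = fixed one
linearise (scale c t)   = scaleˡ c (linearise t)

scaleˡ-sound : ∀ {n} c (s : Linear n) a ρ → ⟦ scaleˡ c s ⟧ˡ a ρ ≡ c * ⟦ s ⟧ˡ a ρ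
scaleˡ-sound c (d ·x)    a ρ = *-assoc c d a
scaleˡ-sound c (fixed u) a ρ = refl

linearise-sound : ∀ {n} (t : Term (suc n)) a ρ → ⟦ t ⟧ₜ (a ∷ₐ ρ) ≡ ⟦ linearise t ⟧ˡ a ρ
linearise-sound (var zero)    a ρ = sym (*-identityˡ a)
linearise-sound (var (suc i)) a ρ = refl
linearise-sound one           a ρ = refl
linearise-sound (scale c t)   a ρ =
  trans (cong (c *_) (linearise-sound t a ρ)) (sym (scaleˡ-sound c (linearise t) a ρ))

-- Quantifier-free formulas in x = var zero with x isolated in every atom; n counts
-- the other variables.
data Solved (n : ℕ) : Set where
  lift    : (ψ : Formula n) → QF ψ → Solved n
  x⟨_⟩_   : Rel → Term n → Solved n
  ¬ˢ_     : Solved n → Solved n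
  _∧ˢ_ _∨ˢ_ _⇒ˢ_ : Solved n → Solved n → Solved n

⟦_⟧ˢ : ∀ {n} → Solved n → ℚ → Assignment n → Set
⟦ lift ψ _ ⟧ˢ a ρ = ρ ⊨ ψ
⟦ x⟨ r ⟩ w ⟧ˢ a ρ = Holds r a (⟦ w ⟧ₜ ρ)
⟦ ¬ˢ φ ⟧ˢ    a ρ = ¬ ⟦ φ ⟧ˢ a ρ
⟦ φ ∧ˢ ψ ⟧ˢ  a ρ = ⟦ φ ⟧ˢ a ρ × ⟦ ψ ⟧ˢ a ρ
⟦ φ ∨ˢ ψ ⟧ˢ  a ρ = ⟦ φ ⟧ˢ a ρ ⊎ ⟦ ψ ⟧ˢ a ρ
⟦ φ ⇒ˢ ψ ⟧ˢ  a ρ = ⟦ φ ⟧ˢ a ρ → ⟦ ψ ⟧ˢ a ρ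

data Sign (c : ℚ) : Set where
  negative : .{{_ : Negative c}} → .{{_ : NonZero c}} → Sign c
  zero     : c ≡ 0ℚ → Sign c
  positive : .{{_ : Positive c}} → .{{_ : NonZero c}} → Sign c

sign : ∀ c → Sign c
sign c with <-cmp c 0ℚ
... | tri< c<0 _ _ = negative {{ℚ.negative c<0}} {{neg⇒nonZero c {{ℚ.negative c<0}}}}
... | tri≈ _ c≡0 _ = zero c≡0
... | tri> _ _ c>0 = positive {{ℚ.positive c>0}} {{pos⇒nonZero c {{ℚ.positive c>0}}}}

𝟘 : ∀ {n} → Term n
𝟘 = scale 0ℚ one

isolate : ∀ {n} → Rel → ℚ → Term n → Solved n
isolate r c v with sign c
... | negative = x⟨ converse r ⟩ scale (1/ c) v
... | zero _   = lift (relᶠ r 𝟘 v) (relᶠ-QF r 𝟘 v)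
... | positive = x⟨ r ⟩ scale (1/ c) v

isolate-sound : ∀ {n} r c (v : Term n) a ρ → Holds r (c * a) (⟦ v ⟧ₜ ρ) ⇔ ⟦ isolate r c v ⟧ˢ a ρ
isolate-sound r c v a ρ with sign c
... | negative = begin
  Holds r (c * a) (⟦ v ⟧ₜ ρ)                   ≈⟨ Holds-cong r refl (p*[1/p*q]≡q c _) ⟨
  Holds r (c * a) (c * (1/ c * ⟦ v ⟧ₜ ρ))      ≈⟨ Holds-*-neg r c ⟩
  Holds (converse r) a (1/ c * ⟦ v ⟧ₜ ρ)       ∎
  where open ⇔-Reasoning
... | zero c≡0 = begin
  Holds r (c * a) (⟦ v ⟧ₜ ρ)                   ≈⟨ Holds-cong r (trans (cong (_* a) c≡0) (*-zeroˡ a)) refl ⟩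
  Holds r 0ℚ (⟦ v ⟧ₜ ρ)                        ≈⟨ relᶠ-sound ρ r 𝟘 v ⟨
  ρ ⊨ relᶠ r 𝟘 v                               ∎
  where open ⇔-Reasoning
... | positive = begin
  Holds r (c * a) (⟦ v ⟧ₜ ρ)                   ≈⟨ Holds-cong r refl (p*[1/p*q]≡q c _) ⟨
  Holds r (c * a) (c * (1/ c * ⟦ v ⟧ₜ ρ))      ≈⟨ Holds-*-pos r c ⟩
  Holds r a (1/ c * ⟦ v ⟧ₜ ρ)                  ∎
  where open ⇔-Reasoning

atom : ∀ {n} → Rel → Linear n → Linear n → Solved n
atom r (fixed u) (fixed v) = lift (relᶠ r u v) (relᶠ-QF r u v)
atom r (c ·x)    (fixed v) = isolate r c v
atom r (fixed u) (c ·x)    = isolate (converse r) c u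
atom r (c ·x)    (d ·x)    = isolate r (c - d) 𝟘

atom-sound : ∀ {n} r (s t : Linear n) a ρ → Holds r (⟦ s ⟧ˡ a ρ) (⟦ t ⟧ˡ a ρ) ⇔ ⟦ atom r s t ⟧ˢ a ρ
atom-sound r (fixed u) (fixed v) a ρ = ⇔.sym (relᶠ-sound ρ r u v)
atom-sound r (c ·x)    (fixed v) a ρ = isolate-sound r c v a ρ
atom-sound r (fixed u) (c ·x)    a ρ = ⇔.trans (Holds-converse r) (isolate-sound (converse r) c u a ρ)
atom-sound r (c ·x)    (d ·x)    a ρ = begin
  Holds r (c * a) (d * a)          ≈⟨ Holds-difference r ⟩
  Holds r (c * a - d * a) 0ℚ       ≈⟨ Holds-cong r ([p-q]*r≡p*r-q*r c d a) refl ⟨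
  Holds r ((c - d) * a) 0ℚ         ≈⟨ isolate-sound r (c - d) 𝟘 a ρ ⟩
  ⟦ isolate r (c - d) 𝟘 ⟧ˢ a ρ     ∎
  where open ⇔-Reasoning

solve : ∀ {n} {ψ : Formula (suc n)} → QF ψ → Solved n
solve ⊤ᶠ       = lift ⊤ᶠ ⊤ᶠ
solve ⊥ᶠ       = lift ⊥ᶠ ⊥ᶠ
solve (s ≐ t)  = atom eq (linearise s) (linearise t)
solve (s ≺ t)  = atom lt (linearise s) (linearise t)
solve (¬ᶠ q)   = ¬ˢ solve q
solve (q ∧ᶠ r) = solve q ∧ˢ solve r
solve (q ∨ᶠ r) = solve q ∨ˢ solve r
solve (q ⇒ᶠ r) = solve q ⇒ˢ solve r

solve-sound : ∀ {n} {ψ : Formula (suc n)} (q : QF ψ) a ρ → (a ∷ₐ ρ) ⊨ ψ ⇔ ⟦ solve q ⟧ˢ a ρ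
solve-sound ⊤ᶠ       a ρ = ⇔.refl
solve-sound ⊥ᶠ       a ρ = ⇔.refl
solve-sound (s ≐ t)  a ρ = ⇔.trans (Holds-cong eq (linearise-sound s a ρ) (linearise-sound t a ρ))
                                   (atom-sound eq (linearise s) (linearise t) a ρ)
solve-sound (s ≺ t)  a ρ = ⇔.trans (Holds-cong lt (linearise-sound s a ρ) (linearise-sound t a ρ))
                                   (atom-sound lt (linearise s) (linearise t) a ρ)
solve-sound (¬ᶠ q)   a ρ = ¬-cong-⇔ (solve-sound q a ρ)
solve-sound (q ∧ᶠ r) a ρ = solve-sound q a ρ ×-⇔ solve-sound r a ρ
solve-sound (q ∨ᶠ r) a ρ = solve-sound q a ρ ⊎-⇔ solve-sound r a ρ
solve-sound (q ⇒ᶠ r) a ρ = →-cong-⇔ (solve-sound q a ρ) (solve-sound r a ρ)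

bounds : ∀ {n} → Solved n → List (Term n)
bounds (lift _ _)  = []
bounds (x⟨ _ ⟩ w)  = w ∷ []
bounds (¬ˢ φ)      = bounds φ
bounds (φ ∧ˢ ψ)    = bounds φ ++ bounds ψ
bounds (φ ∨ˢ ψ)    = bounds φ ++ bounds ψ
bounds (φ ⇒ˢ ψ)    = bounds φ ++ bounds ψ

Instantiation : ℕ → Set
Instantiation n = Rel → Term n → Formula n

infix 25 _[_]

_[_] : ∀ {n} → Solved n → Instantiation n → Formula n
lift ψ _ [ S ]    = ψ
(x⟨ r ⟩ w) [ S ] = S r w
(¬ˢ φ) [ S ]      = ¬ᶠ (φ [ S ])
(φ ∧ˢ ψ) [ S ]    = φ [ S ] ∧ᶠ ψ [ S ]
(φ ∨ˢ ψ) [ S ]    = φ [ S ] ∨ᶠ ψ [ S ]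
(φ ⇒ˢ ψ) [ S ]    = φ [ S ] ⇒ᶠ ψ [ S ]

[]-QF : ∀ {n} {S : Instantiation n} → (∀ r w → QF (S r w)) → ∀ φ → QF (φ [ S ])
[]-QF q (lift _ qψ) = qψ
[]-QF q (x⟨ r ⟩ w)  = q r w
[]-QF q (¬ˢ φ)      = ¬ᶠ []-QF q φ
[]-QF q (φ ∧ˢ ψ)    = []-QF q φ ∧ᶠ []-QF q ψ
[]-QF q (φ ∨ˢ ψ)    = []-QF q φ ∨ᶠ []-QF q ψ
[]-QF q (φ ⇒ˢ ψ)    = []-QF q φ ⇒ᶠ []-QF q ψ

Describes : ∀ {n} → Assignment n → Instantiation n → ℚ → Term n → Set
Describes ρ S a w = ∀ r → Holds r a (⟦ w ⟧ₜ ρ) ⇔ ρ ⊨ S r w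

[]-sound : ∀ {n} {ρ : Assignment n} {S a} φ → All (Describes ρ S a) (bounds φ) → ⟦ φ ⟧ˢ a ρ ⇔ ρ ⊨ φ [ S ]
[]-sound (lift _ _) _         = ⇔.refl
[]-sound (x⟨ r ⟩ w) (d ∷ [])  = d r
[]-sound (¬ˢ φ)     ds        = ¬-cong-⇔ ([]-sound φ ds)
[]-sound (φ ∧ˢ ψ)   ds        = []-sound φ (++⁻ˡ (bounds φ) ds) ×-⇔ []-sound ψ (++⁻ʳ (bounds φ) ds)
[]-sound (φ ∨ˢ ψ)   ds        = []-sound φ (++⁻ˡ (bounds φ) ds) ⊎-⇔ []-sound ψ (++⁻ʳ (bounds φ) ds)
[]-sound (φ ⇒ˢ ψ)   ds        = →-cong-⇔ ([]-sound φ (++⁻ˡ (bounds φ) ds)) ([]-sound ψ (++⁻ʳ (bounds φ) ds))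

at : ∀ {n} → Term n → Instantiation n
at t r = relᶠ r t

−∞ : ∀ {n} → Instantiation n
−∞ lt _ = ⊤ᶠ
−∞ eq _ = ⊥ᶠ
−∞ gt _ = ⊥ᶠ

-- x := t⁺, a point above t but below every bound that lies above t.
_⁺ : ∀ {n} → Term n → Instantiation n
(t ⁺) lt w = t ≺ w
(t ⁺) eq w = ⊥ᶠ
(t ⁺) gt w = ¬ᶠ (t ≺ w)

−∞-QF : ∀ {n} r (w : Term n) → QF (−∞ r w)
−∞-QF lt _ = ⊤ᶠ
−∞-QF eq _ = ⊥ᶠ
−∞-QF gt _ = ⊥ᶠ

⁺-QF : ∀ {n} (t : Term n) r w → QF ((t ⁺) r w)
⁺-QF t lt w = t ≺ w
⁺-QF t eq w = ⊥ᶠ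
⁺-QF t gt w = ¬ᶠ (t ≺ w)

at-describes : ∀ {n} (ρ : Assignment n) t w → Describes ρ (at t) (⟦ t ⟧ₜ ρ) w
at-describes ρ t w r = ⇔.sym (relᶠ-sound ρ r t w)

−∞-describes : ∀ {n} {ρ : Assignment n} {a w} → a < ⟦ w ⟧ₜ ρ → Describes ρ −∞ a w
−∞-describes a<w lt = mk⇔ (λ _ → tt) (λ _ → a<w)
−∞-describes a<w eq = mk⇔ (λ a≡w → <-irrefl a≡w a<w) ⊥-elim
−∞-describes a<w gt = mk⇔ (<-asym a<w) ⊥-elim

⁺-describes : ∀ {n} {ρ : Assignment n} {a} t {w} → ⟦ t ⟧ₜ ρ < a →
              (⟦ t ⟧ₜ ρ < ⟦ w ⟧ₜ ρ → a < ⟦ w ⟧ₜ ρ) → Describes ρ (t ⁺) a w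
⁺-describes {ρ = ρ} {a} t {w} t<a gap = λ where
    lt → mk⇔ (<-trans t<a) gap
    eq → mk⇔ a≢w ⊥-elim
    gt → mk⇔ (λ w<a t<w → <-asym (gap t<w) w<a) t≮w⇒w<a
  where
  t≮w⇒w<a : ¬ (⟦ t ⟧ₜ ρ < ⟦ w ⟧ₜ ρ) → ⟦ w ⟧ₜ ρ < a
  t≮w⇒w<a t≮w = ≤-<-trans (≮⇒≥ t≮w) t<a
  a≢w : a ≢ ⟦ w ⟧ₜ ρ
  a≢w a≡w with ⟦ t ⟧ₜ ρ <? ⟦ w ⟧ₜ ρ
  ... | yes t<w = <-irrefl a≡w (gap t<w)
  ... | no t≮w  = <-irrefl (sym a≡w) (t≮w⇒w<a t≮w)

[at]-sound : ∀ {n} (ρ : Assignment n) φ t → ⟦ φ ⟧ˢ (⟦ t ⟧ₜ ρ) ρ ⇔ ρ ⊨ φ [ at t ]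
[at]-sound ρ φ t = []-sound φ (universal (at-describes ρ t) (bounds φ))

[−∞]-sound : ∀ {n} {ρ : Assignment n} {a} φ →
             All (λ w → a < ⟦ w ⟧ₜ ρ) (bounds φ) → ⟦ φ ⟧ˢ a ρ ⇔ ρ ⊨ φ [ −∞ ]
[−∞]-sound φ a<ws = []-sound φ (All.map (λ {w} → −∞-describes {w = w}) a<ws)

[⁺]-sound : ∀ {n} {ρ : Assignment n} {a} φ t → ⟦ t ⟧ₜ ρ < a →
            Gap (λ w → ⟦ w ⟧ₜ ρ) (⟦ t ⟧ₜ ρ) a (bounds φ) → ⟦ φ ⟧ˢ a ρ ⇔ ρ ⊨ φ [ t ⁺ ]
[⁺]-sound φ t t<a gap = []-sound φ (All.map (λ {w} → ⁺-describes t {w} t<a) gap)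

eliminate : ∀ {n} → Solved n → Formula n
eliminate φ = φ [ −∞ ] ∨ᶠ (⋁ (λ t → φ [ at t ]) (bounds φ) ∨ᶠ ⋁ (λ t → φ [ t ⁺ ]) (bounds φ))

eliminate-QF : ∀ {n} (φ : Solved n) → QF (eliminate φ)
eliminate-QF φ = []-QF −∞-QF φ
  ∨ᶠ (⋁-QF (λ t → []-QF (λ r → relᶠ-QF r t) φ) (bounds φ) ∨ᶠ ⋁-QF (λ t → []-QF (⁺-QF t) φ) (bounds φ))

eliminate-sound : ∀ {n} (ρ : Assignment n) φ → (∃ λ a → ⟦ φ ⟧ˢ a ρ) ⇔ ρ ⊨ eliminate φ
eliminate-sound ρ φ = mk⇔ complete sound
  where
  ws = bounds φ
  ⟦_⟧ = λ (w : Term _) → ⟦ w ⟧ₜ ρ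

  complete : (∃ λ a → ⟦ φ ⟧ˢ a ρ) → ρ ⊨ eliminate φ
  complete (a , s) with any? (λ w → a ≟ ⟦ w ⟧) ws
  ... | yes a∈ws = inj₂ (inj₁ (from (⋁-sound ρ _ ws) (Any.map at-a a∈ws)))
    where
    at-a : ∀ {t} → a ≡ ⟦ t ⟧ → ρ ⊨ φ [ at t ]
    at-a {t} refl = to ([at]-sound ρ φ t) s
  ... | no a∉ws with below-all-or-gap ⟦_⟧ a ws (¬Any⇒All¬ ws a∉ws)
  ...   | inj₁ a<ws = inj₁ (to ([−∞]-sound φ a<ws) s)
  ...   | inj₂ (t , t∈ws , t<a , gap) =
    inj₂ (inj₂ (from (⋁-sound ρ _ ws) (lose t∈ws (to ([⁺]-sound φ t t<a gap) s))))

  sound : ρ ⊨ eliminate φ → ∃ λ a → ⟦ φ ⟧ˢ a ρ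
  sound (inj₁ s) with lower-bound ⟦_⟧ ws
  ... | a , a<ws = a , from ([−∞]-sound φ a<ws) s
  sound (inj₂ (inj₁ s)) with satisfied (to (⋁-sound ρ _ ws) s)
  ... | t , s′ = ⟦ t ⟧ , from ([at]-sound ρ φ t) s′
  sound (inj₂ (inj₂ s)) with satisfied (to (⋁-sound ρ _ ws) s)
  ... | t , s′ with gap-above ⟦_⟧ ⟦ t ⟧ ws
  ...   | a , t<a , gap = a , from ([⁺]-sound φ t t<a gap) s′

QFEquivalent : ∀ {n} → Formula n → Set
QFEquivalent {n} φ = Σ (Formula n) λ ψ → QF ψ × Equivalent φ ψ

∃-elim : ∀ {n} {ψ : Formula (suc n)} → QF ψ → QFEquivalent (∃ᶠ ψ)
∃-elim q = eliminate (solve q) , eliminate-QF (solve q) , λ ρ →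
  ⇔.trans (∃-cong-⇔ λ a → solve-sound q a ρ) (eliminate-sound ρ (solve q))

¬-QFEquivalent : ∀ {n} {φ : Formula n} → QFEquivalent φ → QFEquivalent (¬ᶠ φ)
¬-QFEquivalent (ψ , q , e) = ¬ᶠ ψ , ¬ᶠ q , λ ρ → ¬-cong-⇔ (e ρ)

∧-QFEquivalent : ∀ {n} {φ φ′ : Formula n} → QFEquivalent φ → QFEquivalent φ′ → QFEquivalent (φ ∧ᶠ φ′)
∧-QFEquivalent (ψ , q , e) (ψ′ , q′ , e′) = ψ ∧ᶠ ψ′ , q ∧ᶠ q′ , λ ρ → e ρ ×-⇔ e′ ρ

∨-QFEquivalent : ∀ {n} {φ φ′ : Formula n} → QFEquivalent φ → QFEquivalent φ′ → QFEquivalent (φ ∨ᶠ φ′)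
∨-QFEquivalent (ψ , q , e) (ψ′ , q′ , e′) = ψ ∨ᶠ ψ′ , q ∨ᶠ q′ , λ ρ → e ρ ⊎-⇔ e′ ρ

⇒-QFEquivalent : ∀ {n} {φ φ′ : Formula n} → QFEquivalent φ → QFEquivalent φ′ → QFEquivalent (φ ⇒ᶠ φ′)
⇒-QFEquivalent (ψ , q , e) (ψ′ , q′ , e′) = ψ ⇒ᶠ ψ′ , q ⇒ᶠ q′ , λ ρ → →-cong-⇔ (e ρ) (e′ ρ)

∃-QFEquivalent : ∀ {n} {φ : Formula (suc n)} → QFEquivalent φ → QFEquivalent (∃ᶠ φ)
∃-QFEquivalent (ψ , q , e) with ∃-elim q
... | χ , qχ , eχ = χ , qχ , λ ρ → ⇔.trans (∃-cong-⇔ λ a → e (a ∷ₐ ρ)) (eχ ρ)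

∀-QFEquivalent : ∀ {n} {φ : Formula (suc n)} → QFEquivalent φ → QFEquivalent (∀ᶠ φ)
∀-QFEquivalent {φ = φ} (ψ , q , e) with ∃-elim (¬ᶠ q)
... | χ , qχ , eχ = ¬ᶠ χ , ¬ᶠ qχ , λ ρ → begin
  ρ ⊨ ∀ᶠ φ                     ≈⟨ Π-cong-⇔ (λ a → e (a ∷ₐ ρ)) ⟩
  ((a : ℚ) → (a ∷ₐ ρ) ⊨ ψ)     ≈⟨ ∀⇔¬∃¬ (λ a → QF-dec q (a ∷ₐ ρ)) ⟩
  ρ ⊨ (¬ᶠ ∃ᶠ (¬ᶠ ψ))           ≈⟨ ¬-cong-⇔ (eχ ρ) ⟩
  ρ ⊨ (¬ᶠ χ)                   ∎
  where open ⇔-Reasoning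

theorem2 : ∀ {n} (φ : Formula n) → Σ (Formula n) λ ψ → QF ψ × Equivalent φ ψ
theorem2 ⊤ᶠ        = ⊤ᶠ , ⊤ᶠ , λ _ → ⇔.refl
theorem2 ⊥ᶠ        = ⊥ᶠ , ⊥ᶠ , λ _ → ⇔.refl
theorem2 (s ≐ t)   = s ≐ t , s ≐ t , λ _ → ⇔.refl
theorem2 (s ≺ t)   = s ≺ t , s ≺ t , λ _ → ⇔.refl
theorem2 (¬ᶠ φ)    = ¬-QFEquivalent (theorem2 φ)
theorem2 (φ ∧ᶠ φ′) = ∧-QFEquivalent (theorem2 φ) (theorem2 φ′)
theorem2 (φ ∨ᶠ φ′) = ∨-QFEquivalent (theorem2 φ) (theorem2 φ′)
theorem2 (φ ⇒ᶠ φ′) = ⇒-QFEquivalent (theorem2 φ) (theorem2 φ′)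
theorem2 (∀ᶠ φ)    = ∀-QFEquivalent (theorem2 φ)
theorem2 (∃ᶠ φ)    = ∃-QFEquivalent (theorem2 φ)
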